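{- For positive integers $k$ and $j$, the misère outcome of the partizan Kayles position $kS_1+jS_2$ is $$o^-(kS_1+jS_2)=\begin{cases}\mathcal{N}, & \text{if } k=j, \text{ or if } k<j \text{ and } k+2j\equiv 0 \pmod 3,\\ \mathcal{R}, & \text{if } k>j, \text{ or if } k<j \text{ and } k+2j\equiv 1 \pmod 3,\\ \mathcal{P}, & \text{if } k<j \text{ and } k+2j\equiv 2\pmod 3.\end{cases}$$
   Context: Partizan Kayles is played on $1\times n$ strips of squares; $S_n$ denotes an empty strip of length $n$, and $mG$ denotes the disjunctive sum of $m$ copies of $G$. Left moves by placing a single square on one empty cell; Right moves by placing a domino covering two adjacent empty cells of the same strip. Under misère play a player unable to move on their turn wins. The outcome is $\mathcal{L}$ (Left wins moving first or second), $\mathcal{R}$ (Right wins moving first or second), $\mathcal{N}$ (the first player wins) or $\mathcal{P}$ (the second player wins). -}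

module Defs where

open import Data.Nat using (ℕ; zero; suc; _+_)
open import Data.List using (List; []; _∷_; _++_; replicate)
open import Data.Product using (_×_; ∃)
open import Relation.Nullary using (¬_)
open import Relation.Binary.PropositionalEquality using (_≡_)

-- A position of Partizan Kayles: a list of strip lengths (disjunctive sum
-- of empty strips S_n).  Placing a piece on a strip of length n splits it
-- into two strips of lengths a and b.
Position : Set
Position = List ℕ

-- Left places a single square: strip of length n = 1 + a + b becomes a, b.
data LMove : Position → Position → Set where
  here  : ∀ {n} a b gs → suc (a + b) ≡ n → LMove (n ∷ gs) (a ∷ b ∷ gs)
  there : ∀ n {gs gs'} → LMove gs gs' → LMove (n ∷ gs) (n ∷ gs')

-- Right places a domino: strip of length n = 2 + a + b becomes a, b.
data RMove : Position → Position → Set where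
  here  : ∀ {n} a b gs → suc (suc (a + b)) ≡ n → RMove (n ∷ gs) (a ∷ b ∷ gs)
  there : ∀ n {gs gs'} → RMove gs gs' → RMove (n ∷ gs) (n ∷ gs')

-- Misère play: a player unable to move on their turn wins.
mutual
  data LWinsFirst (G : Position) : Set where
    stuck : (∀ G' → ¬ LMove G G') → LWinsFirst G
    move  : ∀ {G'} → LMove G G' → RLosesFirst G' → LWinsFirst G

  data RLosesFirst (G : Position) : Set where
    lose : ∃ (λ G' → RMove G G') → (∀ G' → RMove G G' → LWinsFirst G') → RLosesFirst G

mutual
  data RWinsFirst (G : Position) : Set where
    stuck : (∀ G' → ¬ RMove G G') → RWinsFirst G
    move  : ∀ {G'} → RMove G G' → LLosesFirst G' → RWinsFirst G

  data LLosesFirst (G : Position) : Set where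
    lose : ∃ (λ G' → LMove G G') → (∀ G' → LMove G G' → RWinsFirst G') → LLosesFirst G

data Outcome : Set where
  𝓛 𝓝 𝓟 𝓡 : Outcome

HasOutcome : Position → Outcome → Set
HasOutcome G 𝓛 = LWinsFirst G × RLosesFirst G
HasOutcome G 𝓡 = RWinsFirst G × LLosesFirst G
HasOutcome G 𝓝 = LWinsFirst G × RWinsFirst G
HasOutcome G 𝓟 = LLosesFirst G × RLosesFirst G

copies : ℕ → ℕ → Position
copies m n = replicate m n

kS1+jS2 : ℕ → ℕ → Position
kS1+jS2 k j = copies k 1 ++ copies j 2

-- Strips of length 0 are dead, so a position only matters through the numbers
-- k of strips S₁ and j of strips S₂: Left either fills an S₁, reaching (k − 1, j),
-- or plays at the end of an S₂, reaching (k + 1, j − 1); Right fills an S₂,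
-- reaching (k, j − 1).  The claimed outcome o(k, j) satisfies
-- o(k + 1, j + 1) = o(k, j), o(k + 1, 0) = 𝓡, and o(0, j) cycles through 𝓝, 𝓟, 𝓡.
-- One checks that it obeys the misère recursion of this counting game; the
-- proof is then an induction lexicographic in (j, k), which every move decreases.
module Submission where

open import Defs
open import Data.Nat using (ℕ; zero; suc; _+_; _*_; _<_; _>_; _≤_; s≤s)
open import Data.Nat.Properties using (≤-refl; <⇒≤; m≤n⇒∃[o]m+o≡n)
open import Data.Nat.DivMod using (_%_; [m+kn]%n≡m%n)
open import Data.Nat.Tactic.RingSolver using (solve-∀)
open import Data.Bool using (Bool; true; false; not)
open import Data.Bool.Properties using (not-involutive)
open import Data.List using ([]; _∷_)
open import Data.Product using (_×_; _,_; ∃; -,_)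
open import Data.Empty using (⊥-elim)
open import Relation.Nullary using (¬_)
open import Relation.Binary.PropositionalEquality using (_≡_; refl; sym; trans; cong; module ≡-Reasoning)

private
  variable
    G G' : Position
    k j : ℕ

data Counts : Position → ℕ → ℕ → Set where
  []   : Counts [] 0 0
  s₀∷_ : Counts G k j → Counts (0 ∷ G) k j
  s₁∷_ : Counts G k j → Counts (1 ∷ G) (suc k) j
  s₂∷_ : Counts G k j → Counts (2 ∷ G) k (suc j)

counts-kS1+jS2 : ∀ k j → Counts (kS1+jS2 k j) k j
counts-kS1+jS2 (suc k) j       = s₁∷ counts-kS1+jS2 k j
counts-kS1+jS2 zero    zero    = []
counts-kS1+jS2 zero    (suc j) = s₂∷ counts-kS1+jS2 zero j

data LeftOption (G : Position) : ℕ → ℕ → Set where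
  fill-single : Counts G k j → LeftOption G (suc k) j
  split-double : Counts G (suc k) j → LeftOption G k (suc j)

left-option : Counts G k j → LMove G G' → LeftOption G' k j
left-option (s₁∷ c) (here zero zero _ refl)       = fill-single (s₀∷ s₀∷ c)
left-option (s₂∷ c) (here zero (suc zero) _ refl) = split-double (s₀∷ s₁∷ c)
left-option (s₂∷ c) (here (suc zero) zero _ refl) = split-double (s₁∷ s₀∷ c)
left-option (s₀∷ c) (there _ m) with left-option c m
... | fill-single c'  = fill-single (s₀∷ c')
... | split-double c' = split-double (s₀∷ c')
left-option (s₁∷ c) (there _ m) with left-option c m
... | fill-single c'  = fill-single (s₁∷ c')
... | split-double c' = split-double (s₁∷ c')
left-option (s₂∷ c) (there _ m) with left-option c m
... | fill-single c'  = fill-single (s₂∷ c')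
... | split-double c' = split-double (s₂∷ c')

no-left-move : Counts G 0 0 → ¬ LMove G G'
no-left-move (s₀∷ c) (there _ m) = no-left-move c m

no-right-move : Counts G k 0 → ¬ RMove G G'
no-right-move (s₀∷ c) (there _ m) = no-right-move c m
no-right-move (s₁∷ c) (there _ m) = no-right-move c m

right-option : Counts G k (suc j) → RMove G G' → Counts G' k j
right-option (s₂∷ c) (here zero zero _ refl) = s₀∷ s₀∷ c
right-option (s₀∷ c) (there _ m) = s₀∷ right-option c m
right-option (s₁∷ c) (there _ m) = s₁∷ right-option c m
right-option {j = zero}  (s₂∷ c) (there _ m) = ⊥-elim (no-right-move c m)
right-option {j = suc j} (s₂∷ c) (there _ m) = s₂∷ right-option c m

fill-single-move : Counts G (suc k) j → ∃ λ G' → LMove G G' × Counts G' k j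
fill-single-move (s₀∷ c) with fill-single-move c
... | _ , m , c' = -, there _ m , s₀∷ c'
fill-single-move (s₁∷ c) = -, here 0 0 _ refl , s₀∷ s₀∷ c
fill-single-move (s₂∷ c) with fill-single-move c
... | _ , m , c' = -, there _ m , s₂∷ c'

split-double-move : Counts G k (suc j) → ∃ λ G' → LMove G G' × Counts G' (suc k) j
split-double-move (s₀∷ c) with split-double-move c
... | _ , m , c' = -, there _ m , s₀∷ c'
split-double-move (s₁∷ c) with split-double-move c
... | _ , m , c' = -, there _ m , s₁∷ c'
split-double-move (s₂∷ c) = -, here 0 1 _ refl , s₀∷ s₁∷ c

domino-move : Counts G k (suc j) → ∃ λ G' → RMove G G' × Counts G' k j
domino-move (s₀∷ c) with domino-move c
... | _ , m , c' = -, there _ m , s₀∷ c'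
domino-move (s₁∷ c) with domino-move c
... | _ , m , c' = -, there _ m , s₁∷ c'
domino-move (s₂∷ c) = -, here 0 0 _ refl , s₀∷ s₀∷ c

twosOutcome : ℕ → Outcome
twosOutcome zero                = 𝓝
twosOutcome (suc zero)          = 𝓟
twosOutcome (suc (suc zero))    = 𝓡
twosOutcome (suc (suc (suc d))) = twosOutcome d

outcome : ℕ → ℕ → Outcome
outcome zero    j       = twosOutcome j
outcome (suc k) zero    = 𝓡
outcome (suc k) (suc j) = outcome k j

leftFirstWins : Outcome → Bool
leftFirstWins 𝓛 = true
leftFirstWins 𝓝 = true
leftFirstWins 𝓟 = false
leftFirstWins 𝓡 = false

rightFirstWins : Outcome → Bool
rightFirstWins 𝓛 = false
rightFirstWins 𝓝 = true
rightFirstWins 𝓟 = false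
rightFirstWins 𝓡 = true

leftWins rightWins : ℕ → ℕ → Bool
leftWins k j  = leftFirstWins (outcome k j)
rightWins k j = rightFirstWins (outcome k j)

leftWins[k,j]≡not-rightWins[k,1+j] : ∀ k j → leftWins k j ≡ not (rightWins k (suc j))
leftWins[k,j]≡not-rightWins[k,1+j] zero 0 = refl
leftWins[k,j]≡not-rightWins[k,1+j] zero 1 = refl
leftWins[k,j]≡not-rightWins[k,1+j] zero 2 = refl
leftWins[k,j]≡not-rightWins[k,1+j] zero (suc (suc (suc j))) = leftWins[k,j]≡not-rightWins[k,1+j] zero j
leftWins[k,j]≡not-rightWins[k,1+j] (suc zero)    zero = refl
leftWins[k,j]≡not-rightWins[k,1+j] (suc (suc k)) zero = refl
leftWins[k,j]≡not-rightWins[k,1+j] (suc k) (suc j) = leftWins[k,j]≡not-rightWins[k,1+j] k j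

rightWins[k,j]≡not-leftWins[1+k,j] : ∀ k j → rightWins k j ≡ not (leftWins (suc k) j)
rightWins[k,j]≡not-leftWins[1+k,j] zero    zero    = refl
rightWins[k,j]≡not-leftWins[1+k,j] (suc k) zero    = refl
rightWins[k,j]≡not-leftWins[1+k,j] k       (suc j) = sym (begin
  not (leftWins k j)                   ≡⟨ cong not (leftWins[k,j]≡not-rightWins[k,1+j] k j) ⟩
  not (not (rightWins k (suc j)))      ≡⟨ not-involutive _ ⟩
  rightWins k (suc j)                  ∎)
  where open ≡-Reasoning

rightWins[1,j]≡not-leftWins[0,1+j] : ∀ j → rightWins 1 j ≡ not (leftWins 0 (suc j))
rightWins[1,j]≡not-leftWins[0,1+j] 0 = refl
rightWins[1,j]≡not-leftWins[0,1+j] 1 = refl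
rightWins[1,j]≡not-leftWins[0,1+j] 2 = refl
rightWins[1,j]≡not-leftWins[0,1+j] 3 = refl
rightWins[1,j]≡not-leftWins[0,1+j] (suc (suc (suc (suc j)))) = rightWins[1,j]≡not-leftWins[0,1+j] (suc j)

leftWins[k,1+j]≡false⇒rightWins[1+k,j]≡true :
  ∀ k j → leftWins k (suc j) ≡ false → rightWins (suc k) j ≡ true
leftWins[k,1+j]≡false⇒rightWins[1+k,j]≡true zero j e =
  trans (rightWins[1,j]≡not-leftWins[0,1+j] j) (cong not e)
leftWins[k,1+j]≡false⇒rightWins[1+k,j]≡true (suc k) zero    _ = refl
leftWins[k,1+j]≡false⇒rightWins[1+k,j]≡true (suc k) (suc j) e =
  leftWins[k,1+j]≡false⇒rightWins[1+k,j]≡true k j e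

mutual
  left-wins : ∀ k j → Counts G k j → leftWins k j ≡ true → LWinsFirst G
  left-wins zero zero c _ = stuck (λ _ → no-left-move c)
  left-wins (suc k) j c e =
    let _ , m , c' = fill-single-move c
    in move m (right-loses k j c' (trans (rightWins[k,j]≡not-leftWins[1+k,j] k j) (cong not e)))
  left-wins zero (suc j) c e =
    let _ , m , c' = split-double-move c
    in move m (right-loses 1 j c' (trans (rightWins[1,j]≡not-leftWins[0,1+j] j) (cong not e)))

  left-loses : ∀ k j → Counts G k j → leftWins k j ≡ false → LLosesFirst G
  left-loses zero zero c ()
  left-loses (suc k) j c e =
    let _ , m , _ = fill-single-move c
    in lose (-, m) (λ _ m' → right-wins-after (left-option c m') e)
  left-loses zero (suc j) c e =
    let _ , m , _ = split-double-move c
    in lose (-, m) (λ _ m' → right-wins-after (left-option c m') e)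

  right-wins-after : LeftOption G' k j → leftWins k j ≡ false → RWinsFirst G'
  right-wins-after {k = suc k} {j} (fill-single c) e =
    right-wins k j c (trans (rightWins[k,j]≡not-leftWins[1+k,j] k j) (cong not e))
  right-wins-after {k = k} {suc j} (split-double c) e =
    right-wins (suc k) j c (leftWins[k,1+j]≡false⇒rightWins[1+k,j]≡true k j e)

  right-wins : ∀ k j → Counts G k j → rightWins k j ≡ true → RWinsFirst G
  right-wins k zero c _ = stuck (λ _ → no-right-move c)
  right-wins k (suc j) c e =
    let _ , m , c' = domino-move c
    in move m (left-loses k j c' (trans (leftWins[k,j]≡not-rightWins[k,1+j] k j) (cong not e)))

  right-loses : ∀ k j → Counts G k j → rightWins k j ≡ false → RLosesFirst G
  right-loses zero    zero c ()
  right-loses (suc k) zero c ()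
  right-loses k (suc j) c e =
    let _ , m , _ = domino-move c
    in lose (-, m) (λ _ m' →
         left-wins k j (right-option c m') (trans (leftWins[k,j]≡not-rightWins[k,1+j] k j) (cong not e)))

counts⇒hasOutcome : Counts G k j → HasOutcome G (outcome k j)
counts⇒hasOutcome {k = k} {j} c with outcome k j in e
... | 𝓛 = left-wins k j c (cong leftFirstWins e) , right-loses k j c (cong rightFirstWins e)
... | 𝓝 = left-wins k j c (cong leftFirstWins e) , right-wins k j c (cong rightFirstWins e)
... | 𝓟 = left-loses k j c (cong leftFirstWins e) , right-loses k j c (cong rightFirstWins e)
... | 𝓡 = right-wins k j c (cong rightFirstWins e) , left-loses k j c (cong leftFirstWins e)

outcome≡𝓡 : j < k → outcome k j ≡ 𝓡
outcome≡𝓡 {zero}  {suc k} _ = refl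
outcome≡𝓡 {suc j} {suc k} (s≤s j<k) = outcome≡𝓡 j<k

-- Residues are below 3, so the last clause only matters for 2.
outcomeOfResidue : ℕ → Outcome
outcomeOfResidue 0 = 𝓝
outcomeOfResidue 1 = 𝓡
outcomeOfResidue _ = 𝓟

m≡n+q*3⇒m%3≡n%3 : ∀ m n q → m ≡ n + q * 3 → m % 3 ≡ n % 3
m≡n+q*3⇒m%3≡n%3 m n q refl = [m+kn]%n≡m%n n q 3

twosOutcome≡outcomeOfResidue : ∀ d → twosOutcome d ≡ outcomeOfResidue ((2 * d) % 3)
twosOutcome≡outcomeOfResidue 0 = refl
twosOutcome≡outcomeOfResidue 1 = refl
twosOutcome≡outcomeOfResidue 2 = refl
twosOutcome≡outcomeOfResidue (suc (suc (suc d))) =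
  trans (twosOutcome≡outcomeOfResidue d)
        (cong outcomeOfResidue (sym (m≡n+q*3⇒m%3≡n%3 _ (2 * d) 2 (2*[3+d]≡2*d+2*3 d))))
  where
  2*[3+d]≡2*d+2*3 : ∀ d → 2 * suc (suc (suc d)) ≡ 2 * d + 2 * 3
  2*[3+d]≡2*d+2*3 = solve-∀

outcome[k,k+d]≡twosOutcome[d] : ∀ k d → outcome k (k + d) ≡ twosOutcome d
outcome[k,k+d]≡twosOutcome[d] zero    d = refl
outcome[k,k+d]≡twosOutcome[d] (suc k) d = outcome[k,k+d]≡twosOutcome[d] k d

outcome≡outcomeOfResidue : k ≤ j → outcome k j ≡ outcomeOfResidue ((k + 2 * j) % 3)
outcome≡outcomeOfResidue {k} k≤j with m≤n⇒∃[o]m+o≡n k≤j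
... | d , refl = begin
  outcome k (k + d)                          ≡⟨ outcome[k,k+d]≡twosOutcome[d] k d ⟩
  twosOutcome d                              ≡⟨ twosOutcome≡outcomeOfResidue d ⟩
  outcomeOfResidue ((2 * d) % 3)             ≡⟨ cong outcomeOfResidue (sym residue) ⟩
  outcomeOfResidue ((k + 2 * (k + d)) % 3)   ∎
  where
  open ≡-Reasoning
  k+2*[k+d]≡2*d+k*3 : ∀ k d → k + 2 * (k + d) ≡ 2 * d + k * 3
  k+2*[k+d]≡2*d+k*3 = solve-∀
  residue : (k + 2 * (k + d)) % 3 ≡ (2 * d) % 3
  residue = m≡n+q*3⇒m%3≡n%3 _ (2 * d) k (k+2*[k+d]≡2*d+k*3 k d)

[k+2*k]%3≡0 : ∀ k → (k + 2 * k) % 3 ≡ 0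
[k+2*k]%3≡0 k = m≡n+q*3⇒m%3≡n%3 _ 0 k (k+2*k≡k*3 k)
  where
  k+2*k≡k*3 : ∀ k → k + 2 * k ≡ 0 + k * 3
  k+2*k≡k*3 = solve-∀

theorem4p1 : (k j : ℕ) → 1 ≤ k → 1 ≤ j →
    (k ≡ j → HasOutcome (kS1+jS2 k j) 𝓝) ×
    (k < j → (k + 2 * j) % 3 ≡ 0 → HasOutcome (kS1+jS2 k j) 𝓝) ×
    (k > j → HasOutcome (kS1+jS2 k j) 𝓡) ×
    (k < j → (k + 2 * j) % 3 ≡ 1 → HasOutcome (kS1+jS2 k j) 𝓡) ×
    (k < j → (k + 2 * j) % 3 ≡ 2 → HasOutcome (kS1+jS2 k j) 𝓟)
theorem4p1 k j _ _ =
  (λ { refl → byResidue ≤-refl ([k+2*k]%3≡0 k) }) ,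
  (λ k<j → byResidue (<⇒≤ k<j)) ,
  (λ j<k → byOutcome (outcome≡𝓡 j<k)) ,
  (λ k<j → byResidue (<⇒≤ k<j)) ,
  (λ k<j → byResidue (<⇒≤ k<j))
  where
  byOutcome : ∀ {o} → outcome k j ≡ o → HasOutcome (kS1+jS2 k j) o
  byOutcome refl = counts⇒hasOutcome (counts-kS1+jS2 k j)
  byResidue : ∀ {r} → k ≤ j → (k + 2 * j) % 3 ≡ r → HasOutcome (kS1+jS2 k j) (outcomeOfResidue r)
  byResidue k≤j refl = byOutcome (outcome≡outcomeOfResidue k≤j)
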